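{- Let $n\ge 2$, and suppose $w\in\mathfrak{S}_n^B$ has pinnacle set $S$. Suppose that either $w(n-1)>w(n)$ and $w(n-1)>-w(n)$, or $w(n-1)<w(n)$ and $w(n-1)<-w(n)$. Define $w'$ by $w'(i)=w(i)$ for $i<n$ and $w'(n)=-w(n)$. Then $w'\in\mathfrak{S}_n^B$, the pinnacle set of $w'$ is also $S$, and $S\in\mathsf{APS}^D_n$.
   Context: $[n]=\{1,\dots,n\}$, $\pm[n]=[n]\cup-[n]$. $\mathfrak{S}_n^B$ is the group of bijections $w:\pm[n]\to\pm[n]$ with $w(-i)=-w(i)$, written in one-line notation $w(1)\cdots w(n)$; $\mathfrak{S}_n^D\subseteq\mathfrak{S}_n^B$ consists of those $w$ with $|\{i\in[n]:w(i)<0\}|$ even. A pinnacle of $w$ is a value $w(i)$ with $2\le i\le n-1$ and $w(i-1)<w(i)>w(i+1)$; the pinnacle set of $w$ is the set of its pinnacles. $\mathsf{APS}^D_n$ is the set of pinnacle sets of elements of $\mathfrak{S}_n^D$. -}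

module Defs where

open import Data.Nat using (ℕ; suc; _≤_; _<_)
open import Data.Nat.Divisibility using (_∣_)
open import Data.Integer as ℤ using (ℤ; ∣_∣; -_; 0ℤ)
open import Data.Fin using (Fin; toℕ; fromℕ; inject₁; _≟_)
open import Data.List using (List; length; filter)
open import Data.List using () renaming (map to mapL)
open import Data.Fin using () renaming (_≟_ to _≟ᶠ_)
open import Data.Product using (Σ; _×_; ∃)
open import Relation.Binary.PropositionalEquality using (_≡_)
open import Relation.Nullary.Decidable using (⌊_⌋)
open import Data.Bool using (if_then_else_)
open import Function.Bundles using (_⇔_)
open import Data.List using (allFin)

-- A word of length n over ℤ, i.e. one-line notation w(1)⋯w(n);
-- index i : Fin n stands for position toℕ i + 1.
Word : ℕ → Set
Word n = Fin n → ℤ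

-- w is (the one-line notation of) an element of 𝔖ⁿ_B: the values lie in ±[n]
-- and their absolute values are pairwise distinct (so w extends uniquely to
-- an odd bijection of ±[n]).
IsSignedPerm : (n : ℕ) → Word n → Set
IsSignedPerm n w =
  (∀ i → 1 ≤ ∣ w i ∣ × ∣ w i ∣ ≤ n) × (∀ i j → ∣ w i ∣ ≡ ∣ w j ∣ → i ≡ j)

negCount : (n : ℕ) → Word n → ℕ
negCount n w = length (filter (λ i → w i ℤ.<? 0ℤ) (allFin n))

IsTypeD : (n : ℕ) → Word n → Set
IsTypeD n w = IsSignedPerm n w × (2 ∣ negCount n w)

IsPinnacle : (n : ℕ) → Word n → ℤ → Set
IsPinnacle n w x =
  Σ (Fin n) λ i → Σ (Fin n) λ j → Σ (Fin n) λ k →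
    (toℕ j ≡ suc (toℕ i)) × (toℕ k ≡ suc (toℕ j)) ×
    (w i ℤ.< w j) × (w k ℤ.< w j) × (x ≡ w j)

HasPinnacleSet : (n : ℕ) → Word n → (ℤ → Set) → Set
HasPinnacleSet n w S = ∀ x → IsPinnacle n w x ⇔ S x

InAPSD : (n : ℕ) → (ℤ → Set) → Set
InAPSD n S = ∃ λ (u : Word n) → IsTypeD n u × HasPinnacleSet n u S

negateLast : (m : ℕ) → Word (suc m) → Word (suc m)
negateLast m w i = if ⌊ i ≟ᶠ fromℕ m ⌋ then - w i else w i

-- Only the comparison between w(n-1) and w(n) involves w(n), and n itself is never a
-- pinnacle position. The hypothesis says that w(n) and -w(n) lie on the same side of
-- w(n-1), so negating w(n) leaves every pinnacle, hence the pinnacle set, unchanged.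
-- Negating the single nonzero entry w(n) changes the number of negative entries by
-- exactly one, so one of w and w' has an even number of them and lies in 𝔖ⁿ_D.
module Submission where

open import Defs
open import Data.Nat as ℕ using (ℕ; zero; suc)
import Data.Nat.Properties as ℕ
open import Data.Nat.Divisibility using (_∣_; divides)
open import Data.Integer using (ℤ; +_; -[1+_]; 0ℤ; ∣_∣; _<_; _>_; _<?_; -_; +<+; -<+)
import Data.Integer.Properties as ℤ
open import Data.Fin using (Fin; toℕ; fromℕ; inject₁; _≟_)
open import Data.Fin.Properties using (toℕ-fromℕ; toℕ-inject₁; toℕ-injective; toℕ<n; fromℕ≢inject₁)
open import Data.List using (_∷_; length; filter; allFin)
open import Data.List.Membership.Propositional using (_∈_)
open import Data.List.Membership.Propositional.Properties using (∈-allFin)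
open import Data.List.Relation.Unary.All as All using (All; []; _∷_)
open import Data.List.Relation.Unary.Any using (here; there)
open import Data.List.Relation.Unary.Unique.Propositional using (Unique; _∷_)
open import Data.List.Relation.Unary.Unique.Propositional.Properties using (allFin⁺)
open import Data.Product using (_×_; _,_; proj₁)
open import Data.Sum using (_⊎_; inj₁; inj₂; swap)
import Data.Sum as Sum
open import Data.Empty using (⊥-elim)
open import Function using (_∘_; id; const)
open import Function.Bundles using (_⇔_; mk⇔; Equivalence)
open import Relation.Nullary using (¬_; yes; no; contradiction)
open import Relation.Unary using (Pred; Decidable)
open import Relation.Binary.PropositionalEquality
  using (_≡_; _≢_; refl; sym; trans; cong; subst; subst₂)

open Equivalence using (to; from)

Adjacent : ℕ → ℕ → Set
Adjacent a b = a ≡ suc b ⊎ b ≡ suc a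

Adjacent-suc : ∀ {a b} → Adjacent a b → Adjacent (suc a) (suc b)
Adjacent-suc = Sum.map (cong suc) (cong suc)

even⊎even-suc : ∀ a → (2 ∣ a) ⊎ (2 ∣ suc a)
even⊎even-suc zero = inj₁ (divides 0 refl)
even⊎even-suc (suc a) with even⊎even-suc a
... | inj₁ (divides q a≡q*2) = inj₂ (divides (suc q) (cong (suc ∘ suc) a≡q*2))
... | inj₂ 2∣1+a = inj₁ 2∣1+a

Adjacent⇒even⊎even : ∀ {a b} → Adjacent a b → (2 ∣ a) ⊎ (2 ∣ b)
Adjacent⇒even⊎even {b = b} (inj₁ refl) = swap (even⊎even-suc b)
Adjacent⇒even⊎even {a = a} (inj₂ refl) = even⊎even-suc a

module _ {a p q} {A : Set a} {P : Pred A p} {Q : Pred A q}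
         (P? : Decidable P) (Q? : Decidable Q) where

  length-filter-cong : ∀ {xs} → All (λ x → P x ⇔ Q x) xs →
                       length (filter P? xs) ≡ length (filter Q? xs)
  length-filter-cong [] = refl
  length-filter-cong {x ∷ _} (Px⇔Qx ∷ rest) with P? x | Q? x
  ... | yes _  | yes _  = cong suc (length-filter-cong rest)
  ... | yes Px | no ¬Qx = contradiction (to Px⇔Qx Px) ¬Qx
  ... | no ¬Px | yes Qx = contradiction (from Px⇔Qx Qx) ¬Px
  ... | no _   | no _   = length-filter-cong rest

  length-filter-flip : ∀ {xs z} → Unique xs → z ∈ xs →
                       (∀ x → x ≢ z → P x ⇔ Q x) → ¬ (P z ⇔ Q z) →
                       Adjacent (length (filter P? xs)) (length (filter Q? xs))
  length-filter-flip {x ∷ _} (x≢xs ∷ _) (here refl) agree flipped with P? x | Q? x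
  ... | yes Px | yes Qx = contradiction (mk⇔ (const Qx) (const Px)) flipped
  ... | yes _  | no _   = inj₁ (cong suc rest)
    where rest = length-filter-cong (All.map (λ x≢y → agree _ (x≢y ∘ sym)) x≢xs)
  ... | no _   | yes _  = inj₂ (cong suc (sym rest))
    where rest = length-filter-cong (All.map (λ x≢y → agree _ (x≢y ∘ sym)) x≢xs)
  ... | no ¬Px | no ¬Qx =
    contradiction (mk⇔ (⊥-elim ∘ ¬Px) (⊥-elim ∘ ¬Qx)) flipped
  length-filter-flip {x ∷ _} (x≢xs ∷ uniq) (there z∈xs) agree flipped
    with P? x | Q? x | agree x (All.lookup x≢xs z∈xs)
  ... | yes _  | yes _  | _     = Adjacent-suc (length-filter-flip uniq z∈xs agree flipped)
  ... | yes Px | no ¬Qx | Px⇔Qx = contradiction (to Px⇔Qx Px) ¬Qx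
  ... | no ¬Px | yes Qx | Px⇔Qx = contradiction (from Px⇔Qx Qx) ¬Px
  ... | no _   | no _   | _     = length-filter-flip uniq z∈xs agree flipped

nonzero⇒negation-flips-sign : ∀ {i} → 1 ℕ.≤ ∣ i ∣ → ¬ ((i < 0ℤ) ⇔ (- i < 0ℤ))
nonzero⇒negation-flips-sign {+ zero} ()
nonzero⇒negation-flips-sign {+ suc n} _ i<0⇔-i<0 with from i<0⇔-i<0 -<+
... | +<+ ()
nonzero⇒negation-flips-sign { -[1+ n ]} _ i<0⇔-i<0 with to i<0⇔-i<0 -<+
... | +<+ ()

negCount-negate-one : ∀ {n} (u v : Word n) (z : Fin n) →
                      (∀ i → i ≢ z → u i ≡ v i) → v z ≡ - u z → 1 ℕ.≤ ∣ u z ∣ →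
                      Adjacent (negCount n u) (negCount n v)
negCount-negate-one {n} u v z agree vz≡-uz uz≢0 =
  length-filter-flip (λ i → u i <? 0ℤ) (λ i → v i <? 0ℤ) (allFin⁺ n) (∈-allFin z)
    (λ i i≢z → subst (λ t → (u i < 0ℤ) ⇔ (t < 0ℤ)) (agree i i≢z) (mk⇔ id id))
    (subst (λ t → ¬ ((u z < 0ℤ) ⇔ (t < 0ℤ))) (sym vz≡-uz) (nonzero⇒negation-flips-sign uz≢0))

IsSignedPerm-resp-∣∣ : ∀ {n} {u v : Word n} → (∀ i → ∣ u i ∣ ≡ ∣ v i ∣) →
                       IsSignedPerm n u → IsSignedPerm n v
IsSignedPerm-resp-∣∣ {n} ∣u∣≡∣v∣ (bounded , injective) =
  (λ i → subst (λ t → 1 ℕ.≤ t × t ℕ.≤ n) (∣u∣≡∣v∣ i) (bounded i)) ,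
  (λ i j ∣vi∣≡∣vj∣ → injective i j (trans (∣u∣≡∣v∣ i) (trans ∣vi∣≡∣vj∣ (sym (∣u∣≡∣v∣ j)))))

negateLast-last : ∀ m (w : Word (suc m)) → negateLast m w (fromℕ m) ≡ - w (fromℕ m)
negateLast-last m w with fromℕ m ≟ fromℕ m
... | yes _ = refl
... | no ≢ = contradiction refl ≢

negateLast-≢ : ∀ m (w : Word (suc m)) {i} → i ≢ fromℕ m → negateLast m w i ≡ w i
negateLast-≢ m w {i} i≢last with i ≟ fromℕ m
... | yes i≡last = contradiction i≡last i≢last
... | no _ = refl

∣negateLast∣ : ∀ m (w : Word (suc m)) i → ∣ negateLast m w i ∣ ≡ ∣ w i ∣
∣negateLast∣ m w i with i ≟ fromℕ m
... | yes _ = ℤ.∣-i∣≡∣i∣ (w i)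
... | no _ = refl

successor≢fromℕ : ∀ {n} {j k : Fin (suc n)} → toℕ k ≡ suc (toℕ j) → j ≢ fromℕ n
successor≢fromℕ {n} {k = k} k≡1+j refl =
  ℕ.<-irrefl refl (subst (ℕ._< suc n) (trans k≡1+j (cong suc (toℕ-fromℕ n))) (toℕ<n k))

predecessor-of-fromℕ : ∀ {m} {j k : Fin (suc (suc m))} → toℕ k ≡ suc (toℕ j) →
                       k ≡ fromℕ (suc m) → j ≡ inject₁ (fromℕ m)
predecessor-of-fromℕ {m} {j} k≡1+j refl = toℕ-injective (trans toℕj≡m (sym toℕ-penult))
  where
  toℕj≡m : toℕ j ≡ m
  toℕj≡m = ℕ.suc-injective (trans (sym k≡1+j) (toℕ-fromℕ (suc m)))
  toℕ-penult : toℕ (inject₁ (fromℕ m)) ≡ m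
  toℕ-penult = trans (toℕ-inject₁ (fromℕ m)) (toℕ-fromℕ m)

IsPinnacle-transfer : ∀ {m} (u v : Word (suc (suc m))) →
  (∀ i → i ≢ fromℕ (suc m) → u i ≡ v i) →
  (u (fromℕ (suc m)) < u (inject₁ (fromℕ m)) → v (fromℕ (suc m)) < v (inject₁ (fromℕ m))) →
  ∀ {x} → IsPinnacle _ u x → IsPinnacle _ v x
IsPinnacle-transfer {m} u v agree last<penult {x} (i , j , k , j≡1+i , k≡1+j , ui<uj , uk<uj , x≡uj) =
  i , j , k , j≡1+i , k≡1+j , subst₂ _<_ ui≡vi uj≡vj ui<uj , vk<vj , trans x≡uj uj≡vj
  where
  uj≡vj : u j ≡ v j
  uj≡vj = agree j (successor≢fromℕ k≡1+j)
  ui≡vi : u i ≡ v i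
  ui≡vi = agree i (successor≢fromℕ j≡1+i)
  vk<vj : v k < v j
  vk<vj with k ≟ fromℕ (suc m)
  ... | no k≢last = subst₂ _<_ (agree k k≢last) uj≡vj uk<uj
  ... | yes refl with predecessor-of-fromℕ k≡1+j refl
  ...   | refl = last<penult uk<uj

HasPinnacleSet-transfer : ∀ {m} (u v : Word (suc (suc m))) {S : ℤ → Set} →
  (∀ i → i ≢ fromℕ (suc m) → u i ≡ v i) →
  (u (fromℕ (suc m)) < u (inject₁ (fromℕ m)) ⇔ v (fromℕ (suc m)) < v (inject₁ (fromℕ m))) →
  HasPinnacleSet _ u S → HasPinnacleSet _ v S
HasPinnacleSet-transfer u v agree last<penult pinnacles x =
  mk⇔ (to (pinnacles x) ∘ IsPinnacle-transfer v u (λ i i≢last → sym (agree i i≢last)) (from last<penult))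
      (IsPinnacle-transfer u v agree (to last<penult) ∘ from (pinnacles x))

same-side : ∀ {p x y : ℤ} → (x < p × y < p) ⊎ (p < x × p < y) → (x < p ⇔ y < p)
same-side (inj₁ (x<p , y<p)) = mk⇔ (const y<p) (const x<p)
same-side (inj₂ (p<x , p<y)) = mk⇔ (⊥-elim ∘ ℤ.<-asym p<x) (⊥-elim ∘ ℤ.<-asym p<y)

lemma4p1 : (m : ℕ) (w : Word (suc (suc m))) (S : ℤ → Set) →
    IsSignedPerm (suc (suc m)) w →
    HasPinnacleSet (suc (suc m)) w S →
    ((w (inject₁ (fromℕ m)) > w (fromℕ (suc m))) × (w (inject₁ (fromℕ m)) > - w (fromℕ (suc m)))
      ⊎ (w (inject₁ (fromℕ m)) < w (fromℕ (suc m))) × (w (inject₁ (fromℕ m)) < - w (fromℕ (suc m)))) →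
    IsSignedPerm (suc (suc m)) (negateLast (suc m) w)
      × HasPinnacleSet (suc (suc m)) (negateLast (suc m) w) S
      × InAPSD (suc (suc m)) S
lemma4p1 m w S signed pinnacles side = signed′ , pinnacles′ , apsD
  where
  w′ : Word (suc (suc m))
  w′ = negateLast (suc m) w
  last penult : Fin (suc (suc m))
  last = fromℕ (suc m)
  penult = inject₁ (fromℕ m)

  agree : ∀ i → i ≢ last → w i ≡ w′ i
  agree i i≢last = sym (negateLast-≢ (suc m) w i≢last)

  signed′ : IsSignedPerm _ w′
  signed′ = IsSignedPerm-resp-∣∣ {u = w} {v = w′} (sym ∘ ∣negateLast∣ (suc m) w) signed

  descent : w last < w penult ⇔ w′ last < w′ penult
  descent = subst₂ (λ a b → w last < w penult ⇔ a < b)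
                   (sym (negateLast-last (suc m) w)) (agree penult (fromℕ≢inject₁ ∘ sym))
                   (same-side side)

  pinnacles′ : HasPinnacleSet _ w′ S
  pinnacles′ = HasPinnacleSet-transfer w w′ agree descent pinnacles

  negCounts : Adjacent (negCount _ w) (negCount _ w′)
  negCounts = negCount-negate-one w w′ last agree
                (negateLast-last (suc m) w) (proj₁ (proj₁ signed last))

  apsD : InAPSD _ S
  apsD with Adjacent⇒even⊎even negCounts
  ... | inj₁ even = w , (signed , even) , pinnacles
  ... | inj₂ even = w′ , (signed′ , even) , pinnacles′
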